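{- Let $A$ be a pseudo-hoop and $\mu$ a type II state operator on $A$. Then: (1) for all $x,y\in A$ with $y\le x$, $\mu(x\rightarrow y)=\mu(x)\rightarrow\mu(y)$ and $\mu(x\rightsquigarrow y)=\mu(x)\rightsquigarrow\mu(y)$; (2) if $A$ is bounded, then ${\rm Ker}(\mu)=\{x\in A\mid \mu(x)=1\}$ is an involutive filter of $A$.
   Context: A pseudo-hoop is an algebra $(A,\odot,\rightarrow,\rightsquigarrow,1)$ of type $(2,2,2,0)$ such that for all $x,y,z\in A$: $x\odot 1=1\odot x=x$; $x\rightarrow x=x\rightsquigarrow x=1$; $(x\odot y)\rightarrow z=x\rightarrow(y\rightarrow z)$; $(x\odot y)\rightsquigarrow z=y\rightsquigarrow(x\rightsquigarrow z)$; $(x\rightarrow y)\odot x=(y\rightarrow x)\odot y=x\odot(x\rightsquigarrow y)=y\odot(y\rightsquigarrow x)$. The order is $x\le y$ iff $x\rightarrow y=1$. It is bounded if it has a least element $0$; then $x^-=x\rightarrow 0$, $x^\sim=x\rightsquigarrow 0$, $x^{ -\sim}=(x^-)^\sim$, $x^{\sim- }=(x^\sim)^-$. Put $x\vee_1 y=(x\rightarrow y)\rightsquigarrow y$, $x\vee_2 y=(x\rightsquigarrow y)\rightarrow y$. A type II state operator is a map $\mu:A\to A$ such that for all $x,y$: $\mu(x\rightarrow y)=\mu(y\vee_1 x)\rightarrow\mu(y)$ and $\mu(x\rightsquigarrow y)=\mu(y\vee_2 x)\rightsquigarrow\mu(y)$; $\mu(x\odot y)=\mu(x)\odot\mu(x\rightsquigarrow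 x\odot y)=\mu(y\rightarrow x\odot y)\odot\mu(y)$; $\mu(\mu(x)\odot\mu(y))=\mu(x)\odot\mu(y)$; $\mu(\mu(x)\rightarrow\mu(y))=\mu(x)\rightarrow\mu(y)$ and $\mu(\mu(x)\rightsquigarrow\mu(y))=\mu(x)\rightsquigarrow\mu(y)$. A filter is a nonempty $F\subseteq A$ closed under $\odot$ and upward closed; it is involutive if $x^{ -\sim}\rightarrow x\in F$ and $x^{\sim- }\rightsquigarrow x\in F$ for all $x$. -}

module Defs where

open import Level using (Level; suc; _⊔_)
open import Relation.Binary.PropositionalEquality using (_≡_)
open import Data.Product using (Σ; ∃; _×_)

record PseudoHoop (a : Level) : Set (suc a) where
  infixl 7 _⊙_
  infixr 5 _⇒_ _⇝_
  field
    Carrier : Set a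
    _⊙_ : Carrier → Carrier → Carrier
    _⇒_ : Carrier → Carrier → Carrier
    _⇝_ : Carrier → Carrier → Carrier
    𝟏   : Carrier
    ⊙-identityʳ : ∀ x → x ⊙ 𝟏 ≡ x
    ⊙-identityˡ : ∀ x → 𝟏 ⊙ x ≡ x
    ⇒-refl : ∀ x → x ⇒ x ≡ 𝟏
    ⇝-refl : ∀ x → x ⇝ x ≡ 𝟏
    ⇒-curry : ∀ x y z → (x ⊙ y) ⇒ z ≡ x ⇒ (y ⇒ z)
    ⇝-curry : ∀ x y z → (x ⊙ y) ⇝ z ≡ y ⇝ (x ⇝ z)
    divisibility₁ : ∀ x y → (x ⇒ y) ⊙ x ≡ (y ⇒ x) ⊙ y
    divisibility₂ : ∀ x y → (y ⇒ x) ⊙ y ≡ x ⊙ (x ⇝ y)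
    divisibility₃ : ∀ x y → x ⊙ (x ⇝ y) ≡ y ⊙ (y ⇝ x)

  _≤_ : Carrier → Carrier → Set a
  x ≤ y = x ⇒ y ≡ 𝟏

  _∨₁_ : Carrier → Carrier → Carrier
  x ∨₁ y = (x ⇒ y) ⇝ y

  _∨₂_ : Carrier → Carrier → Carrier
  x ∨₂ y = (x ⇝ y) ⇒ y

  IsLeast : Carrier → Set a
  IsLeast z = ∀ x → z ≤ x

  Bounded : Set a
  Bounded = ∃ IsLeast

  record IsTypeIIStateOperator (μ : Carrier → Carrier) : Set a where
    field
      μ-⇒ : ∀ x y → μ (x ⇒ y) ≡ μ (y ∨₁ x) ⇒ μ y
      μ-⇝ : ∀ x y → μ (x ⇝ y) ≡ μ (y ∨₂ x) ⇝ μ y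
      μ-⊙₁ : ∀ x y → μ (x ⊙ y) ≡ μ x ⊙ μ (x ⇝ x ⊙ y)
      μ-⊙₂ : ∀ x y → μ (x ⊙ y) ≡ μ (y ⇒ x ⊙ y) ⊙ μ y
      μ-μ⊙ : ∀ x y → μ (μ x ⊙ μ y) ≡ μ x ⊙ μ y
      μ-μ⇒ : ∀ x y → μ (μ x ⇒ μ y) ≡ μ x ⇒ μ y
      μ-μ⇝ : ∀ x y → μ (μ x ⇝ μ y) ≡ μ x ⇝ μ y

  record IsFilter (F : Carrier → Set a) : Set a where
    field
      nonempty : ∃ F
      ⊙-closed : ∀ {x y} → F x → F y → F (x ⊙ y)
      up-closed : ∀ {x y} → F x → x ≤ y → F y

  record IsInvolutiveFilter (𝟎 : Carrier) (F : Carrier → Set a) : Set a where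
    _⁻ : Carrier → Carrier
    x ⁻ = x ⇒ 𝟎
    _∼ : Carrier → Carrier
    x ∼ = x ⇝ 𝟎
    field
      isFilter : IsFilter F
      inv₁ : ∀ x → F (((x ⁻) ∼) ⇒ x)
      inv₂ : ∀ x → F (((x ∼) ⁻) ⇝ x)

  Ker : (Carrier → Carrier) → Carrier → Set a
  Ker μ x = μ x ≡ 𝟏

-- For y ≤ x the join y ∨₁ x collapses to x, so the defining identity of μ on x → y
-- becomes μ(x → y) = μ x → μ y (and dually for ⇝). For the kernel, x⁻∼ is literally
-- x ∨₁ 0 and x ≤ x⁻∼, so μ(x⁻∼ → x) = μ(x ∨₁ 0) → μ x = μ(0 → x) = μ 1 = 1.
module Submission where

open import Defs
open import Level using (Level)
open import Relation.Binary.PropositionalEquality using (_≡_; sym; trans; cong; module ≡-Reasoning)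
open import Data.Product using (_×_; _,_)

module PseudoHoopProperties {a : Level} (A : PseudoHoop a) where
  open PseudoHoop A
  open import Algebra.Definitions (_≡_ {A = Carrier}) using (LeftIdentity; RightZero; RightConical)
  open ≡-Reasoning

  [x⇒y]⊙x≡x⊙[x⇝y] : ∀ x y → (x ⇒ y) ⊙ x ≡ x ⊙ (x ⇝ y)
  [x⇒y]⊙x≡x⊙[x⇝y] x y = trans (divisibility₂ y x) (divisibility₃ y x)

  ⇒-mp : ∀ x y → ((x ⇒ y) ⊙ x) ≤ y
  ⇒-mp x y = trans (⇒-curry (x ⇒ y) x y) (⇒-refl (x ⇒ y))

  x≤y⇒[y⇒x]⊙y≡x : ∀ {x y} → x ≤ y → (y ⇒ x) ⊙ y ≡ x
  x≤y⇒[y⇒x]⊙y≡x {x} {y} x≤y = begin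
    (y ⇒ x) ⊙ y  ≡⟨ divisibility₁ x y ⟨
    (x ⇒ y) ⊙ x  ≡⟨ cong (_⊙ x) x≤y ⟩
    𝟏 ⊙ x        ≡⟨ ⊙-identityˡ x ⟩
    x            ∎

  ≤-antisym : ∀ {x y} → x ≤ y → y ≤ x → x ≡ y
  ≤-antisym {x} {y} x≤y y≤x = begin
    x            ≡⟨ x≤y⇒[y⇒x]⊙y≡x x≤y ⟨
    (y ⇒ x) ⊙ y  ≡⟨ divisibility₁ x y ⟨
    (x ⇒ y) ⊙ x  ≡⟨ x≤y⇒[y⇒x]⊙y≡x y≤x ⟩
    y            ∎

  ⇒-identityˡ : LeftIdentity 𝟏 _⇒_
  ⇒-identityˡ x = ≤-antisym [𝟏⇒x]≤x x≤𝟏⇒x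
    where
    [𝟏⇒x]≤x : (𝟏 ⇒ x) ≤ x
    [𝟏⇒x]≤x = trans (cong (_⇒ x) (sym (⊙-identityʳ (𝟏 ⇒ x)))) (⇒-mp 𝟏 x)
    x≤𝟏⇒x : x ≤ (𝟏 ⇒ x)
    x≤𝟏⇒x = trans (sym (⇒-curry x 𝟏 x)) (trans (cong (_⇒ x) (⊙-identityʳ x)) (⇒-refl x))

  ⇝-identityˡ : LeftIdentity 𝟏 _⇝_
  ⇝-identityˡ x = begin
    𝟏 ⇝ x        ≡⟨ ⊙-identityˡ (𝟏 ⇝ x) ⟨
    𝟏 ⊙ (𝟏 ⇝ x)  ≡⟨ [x⇒y]⊙x≡x⊙[x⇝y] 𝟏 x ⟨
    (𝟏 ⇒ x) ⊙ 𝟏  ≡⟨ ⊙-identityʳ (𝟏 ⇒ x) ⟩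
    𝟏 ⇒ x        ≡⟨ ⇒-identityˡ x ⟩
    x            ∎

  ⇒-zeroʳ : RightZero 𝟏 _⇒_
  ⇒-zeroʳ x = begin
    x ⇒ 𝟏                ≡⟨ cong (_⇒ 𝟏) [x⇒𝟏]⊙x≡x ⟨
    ((x ⇒ 𝟏) ⊙ x) ⇒ 𝟏    ≡⟨ ⇒-mp x 𝟏 ⟩
    𝟏                    ∎
    where
    [x⇒𝟏]⊙x≡x : (x ⇒ 𝟏) ⊙ x ≡ x
    [x⇒𝟏]⊙x≡x = trans (divisibility₁ x 𝟏) (trans (⊙-identityʳ (𝟏 ⇒ x)) (⇒-identityˡ x))

  ⊙-conicalʳ : RightConical 𝟏 _⊙_
  ⊙-conicalʳ x y x⊙y≡𝟏 = begin
    y                ≡⟨ ⇒-identityˡ y ⟨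
    𝟏 ⇒ y            ≡⟨ cong (_⇒ y) x⊙y≡𝟏 ⟨
    (x ⊙ y) ⇒ y      ≡⟨ ⇒-curry x y y ⟩
    x ⇒ (y ⇒ y)      ≡⟨ cong (x ⇒_) (⇒-refl y) ⟩
    x ⇒ 𝟏            ≡⟨ ⇒-zeroʳ x ⟩
    𝟏                ∎

  ≤⇒⇝≡𝟏 : ∀ {x y} → x ≤ y → x ⇝ y ≡ 𝟏
  ≤⇒⇝≡𝟏 {x} {y} x≤y = begin
    x ⇝ y                  ≡⟨ cong (_⇝ y) x⊙[x⇝y]≡x ⟨
    (x ⊙ (x ⇝ y)) ⇝ y      ≡⟨ ⇝-curry x (x ⇝ y) y ⟩
    (x ⇝ y) ⇝ (x ⇝ y)      ≡⟨ ⇝-refl (x ⇝ y) ⟩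
    𝟏                      ∎
    where
    x⊙[x⇝y]≡x : x ⊙ (x ⇝ y) ≡ x
    x⊙[x⇝y]≡x = trans (sym ([x⇒y]⊙x≡x⊙[x⇝y] x y)) (trans (cong (_⊙ x) x≤y) (⊙-identityˡ x))

  ⇝≡𝟏⇒≤ : ∀ {x y} → x ⇝ y ≡ 𝟏 → x ≤ y
  ⇝≡𝟏⇒≤ {x} {y} x⇝y≡𝟏 = trans (cong (_⇒ y) (sym [x⇒y]⊙x≡x)) (⇒-mp x y)
    where
    [x⇒y]⊙x≡x : (x ⇒ y) ⊙ x ≡ x
    [x⇒y]⊙x≡x = trans ([x⇒y]⊙x≡x⊙[x⇝y] x y) (trans (cong (x ⊙_) x⇝y≡𝟏) (⊙-identityʳ x))

  x≤x∨₁y : ∀ x y → x ≤ (x ∨₁ y)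
  x≤x∨₁y x y = ⇝≡𝟏⇒≤ (trans (sym (⇝-curry (x ⇒ y) x y)) (≤⇒⇝≡𝟏 (⇒-mp x y)))

  x≤x∨₂y : ∀ x y → x ≤ (x ∨₂ y)
  x≤x∨₂y x y = begin
    x ⇒ ((x ⇝ y) ⇒ y)      ≡⟨ ⇒-curry x (x ⇝ y) y ⟨
    (x ⊙ (x ⇝ y)) ⇒ y      ≡⟨ cong (_⇒ y) ([x⇒y]⊙x≡x⊙[x⇝y] x y) ⟨
    ((x ⇒ y) ⊙ x) ⇒ y      ≡⟨ ⇒-mp x y ⟩
    𝟏                      ∎

  y≤x⇒y∨₁x≡x : ∀ {x y} → y ≤ x → y ∨₁ x ≡ x
  y≤x⇒y∨₁x≡x {x} y≤x = trans (cong (_⇝ x) y≤x) (⇝-identityˡ x)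

  y≤x⇒y∨₂x≡x : ∀ {x y} → y ≤ x → y ∨₂ x ≡ x
  y≤x⇒y∨₂x≡x {x} y≤x = trans (cong (_⇒ x) (≤⇒⇝≡𝟏 y≤x)) (⇒-identityˡ x)

module TypeIIStateOperatorProperties {a : Level} (A : PseudoHoop a)
  {μ : PseudoHoop.Carrier A → PseudoHoop.Carrier A}
  (isStateOperator : PseudoHoop.IsTypeIIStateOperator A μ) where
  open PseudoHoop A
  open IsTypeIIStateOperator isStateOperator
  open PseudoHoopProperties A

  μ-⇒-≤ : ∀ {x y} → y ≤ x → μ (x ⇒ y) ≡ μ x ⇒ μ y
  μ-⇒-≤ {x} {y} y≤x = trans (μ-⇒ x y) (cong (λ z → μ z ⇒ μ y) (y≤x⇒y∨₁x≡x y≤x))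

  μ-⇝-≤ : ∀ {x y} → y ≤ x → μ (x ⇝ y) ≡ μ x ⇝ μ y
  μ-⇝-≤ {x} {y} y≤x = trans (μ-⇝ x y) (cong (λ z → μ z ⇝ μ y) (y≤x⇒y∨₂x≡x y≤x))

  μ-𝟏 : μ 𝟏 ≡ 𝟏
  μ-𝟏 = trans (cong μ (sym (⇒-refl 𝟏))) (trans (μ-⇒-≤ (⇒-refl 𝟏)) (⇒-refl (μ 𝟏)))

  μ-∨₁-⇒ : ∀ x y → μ ((x ∨₁ y) ⇒ x) ≡ μ (y ⇒ x)
  μ-∨₁-⇒ x y = trans (μ-⇒-≤ (x≤x∨₁y x y)) (sym (μ-⇒ y x))

  μ-∨₂-⇝ : ∀ x y → μ ((x ∨₂ y) ⇝ x) ≡ μ (y ⇝ x)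
  μ-∨₂-⇝ x y = trans (μ-⇝-≤ (x≤x∨₂y x y)) (sym (μ-⇝ y x))

  Ker-up-closed : ∀ {x y} → Ker μ x → x ≤ y → Ker μ y
  Ker-up-closed {x} {y} μx≡𝟏 x≤y = ⊙-conicalʳ (μ (y ⇒ (y ⇒ x) ⊙ y)) (μ y) (begin
    μ (y ⇒ (y ⇒ x) ⊙ y) ⊙ μ y  ≡⟨ μ-⊙₂ (y ⇒ x) y ⟨
    μ ((y ⇒ x) ⊙ y)            ≡⟨ cong μ (x≤y⇒[y⇒x]⊙y≡x x≤y) ⟩
    μ x                        ≡⟨ μx≡𝟏 ⟩
    𝟏                          ∎)
    where open ≡-Reasoning

  Ker-⊙-closed : ∀ {x y} → Ker μ x → Ker μ y → Ker μ (x ⊙ y)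
  Ker-⊙-closed {x} {y} μx≡𝟏 μy≡𝟏 = begin
    μ (x ⊙ y)                      ≡⟨ μ-⊙₂ x y ⟩
    μ (y ⇒ x ⊙ y) ⊙ μ y            ≡⟨ cong (μ (y ⇒ x ⊙ y) ⊙_) μy≡𝟏 ⟩
    μ (y ⇒ x ⊙ y) ⊙ 𝟏              ≡⟨ ⊙-identityʳ (μ (y ⇒ x ⊙ y)) ⟩
    μ (y ⇒ x ⊙ y)                  ≡⟨ Ker-up-closed μx≡𝟏 x≤y⇒x⊙y ⟩
    𝟏                              ∎
    where
    open ≡-Reasoning
    x≤y⇒x⊙y : x ≤ (y ⇒ x ⊙ y)
    x≤y⇒x⊙y = trans (sym (⇒-curry x y (x ⊙ y))) (⇒-refl (x ⊙ y))

  Ker-isFilter : IsFilter (Ker μ)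
  Ker-isFilter = record
    { nonempty  = 𝟏 , μ-𝟏
    ; ⊙-closed  = Ker-⊙-closed
    ; up-closed = Ker-up-closed
    }

  -- x⁻∼ and x∼⁻ are, by definition, x ∨₁ 0 and x ∨₂ 0.
  Ker-isInvolutiveFilter : ∀ 𝟎 → IsLeast 𝟎 → IsInvolutiveFilter 𝟎 (Ker μ)
  Ker-isInvolutiveFilter 𝟎 𝟎-least = record
    { isFilter = Ker-isFilter
    ; inv₁     = λ x → trans (μ-∨₁-⇒ x 𝟎) (trans (cong μ (𝟎-least x)) μ-𝟏)
    ; inv₂     = λ x → trans (μ-∨₂-⇝ x 𝟎) (trans (cong μ (≤⇒⇝≡𝟏 (𝟎-least x))) μ-𝟏)
    }

proposition5p11 : ∀ {a : Level} (A : PseudoHoop a) (μ : PseudoHoop.Carrier A → PseudoHoop.Carrier A) →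
    PseudoHoop.IsTypeIIStateOperator A μ →
    (∀ x y → PseudoHoop._≤_ A y x →
      (μ (PseudoHoop._⇒_ A x y) ≡ PseudoHoop._⇒_ A (μ x) (μ y))
      × (μ (PseudoHoop._⇝_ A x y) ≡ PseudoHoop._⇝_ A (μ x) (μ y)))
    × (∀ (𝟎 : PseudoHoop.Carrier A) → PseudoHoop.IsLeast A 𝟎 →
        PseudoHoop.IsInvolutiveFilter A 𝟎 (PseudoHoop.Ker A μ))
proposition5p11 A μ isStateOperator =
  (λ x y y≤x → μ-⇒-≤ y≤x , μ-⇝-≤ y≤x) , Ker-isInvolutiveFilter
  where open TypeIIStateOperatorProperties A isStateOperator
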